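{- For $r\in\mathbb{N}$, $$\sum_{\ell=0}^{r-1}\binom{r-1}{\ell}\frac{(-1)^\ell}{\ell+1}\big(H(\ell)-2H(2\ell+1)\big)=-\frac{(2r)!!}{r^2(2r-1)!!}.$$
   Context: $H(n)=\sum_{k=1}^n\frac1k$ with $H(0)=0$; $n!!$ is the double factorial. -}

module Defs where

open import Data.Nat as ℕ using (ℕ; zero; suc; NonZero)
open import Data.Nat.Properties using (m*n≢0)
open import Data.Integer using (+_)
open import Data.Rational using (ℚ; 0ℚ; _+_; _/_)

H : ℕ → ℚ
H zero    = 0ℚ
H (suc n) = H n + (+ 1) / suc n

infix 10 _!!
_!! : ℕ → ℕ
zero !!          = 1
suc zero !!      = 1
suc (suc n) !!   = suc (suc n) ℕ.* (n !!)

sumTo : ℕ → (ℕ → ℚ) → ℚ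
sumTo zero    f = 0ℚ
sumTo (suc n) f = sumTo n f + f n

!!≢0 : ∀ n → NonZero (n !!)
!!≢0 zero = _
!!≢0 (suc zero) = _
!!≢0 (suc (suc n)) = m*n≢0 (suc (suc n)) (n !!) {{_}} {{ !!≢0 n }}

module Submission where

-- For r = n + 1 the left-hand side is an alternating binomial sum, i.e. the
-- n-th signed iterated difference  Δⁿx = Σ_{j≤n} C(n,j) (-1)^j x_j  of the
-- sequence  y_j = a_j / (j+1),  where  a_j = H(j) − 2 H(2j+1).
-- Δ is defined by the recursion Δ⁰x = x₀, Δⁿ⁺¹x = Δⁿx − Δⁿ(x ∘ suc), and the
-- binomial expansion is proved afterwards.

open import Defs
open import Level using (0ℓ)
open import Data.Maybe using (Maybe; just; nothing)
open import Data.Nat as ℕ using (ℕ; NonZero; _∸_; zero; suc)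
import Data.Nat
import Data.Nat.Properties as ℕ
open import Data.Nat.Properties using (m*n≢0)
import Data.Nat.Tactic.RingSolver as ℕ-Solver
open import Data.Nat.Combinatorics using (_C_; nCk+nC[k+1]≡[n+1]C[k+1]; k>n⇒nCk≡0)
open import Data.Integer as ℤ using (+_; -1ℤ; _^_)
import Data.Integer.Properties as ℤ
open import Data.Rational using (ℚ; 0ℚ; 1ℚ; _+_; _-_; _*_; _/_; -_; toℚᵘ)
open import Data.Rational.Properties
  using ( +-*-commutativeRing; _≟_; /-cong
        ; toℚᵘ-injective; toℚᵘ-fromℚᵘ; fromℚᵘ-cong
        ; toℚᵘ-homo-+; toℚᵘ-homo-*; toℚᵘ-homo‿-
        ; +-identityˡ; +-identityʳ; +-assoc; +-comm; +-inverseʳ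
        ; *-identityˡ; *-identityʳ; *-assoc; *-comm; *-zeroˡ; neg-distribˡ-* )
import Data.Rational.Unnormalised as ℚᵘ
import Data.Rational.Unnormalised.Properties as ℚᵘ
open import Function using (_∘_)
open import Relation.Nullary using (yes; no)
open import Relation.Binary.PropositionalEquality
open import Tactic.RingSolver.Core.AlmostCommutativeRing using (AlmostCommutativeRing; fromCommutativeRing)
open import Tactic.RingSolver using (solve-∀)

ℚ-ring : AlmostCommutativeRing 0ℓ 0ℓ
ℚ-ring = fromCommutativeRing +-*-commutativeRing isZero
  where
  isZero : (x : ℚ) → Maybe (0ℚ ≡ x)
  isZero x with 0ℚ ≟ x
  ... | yes 0≡x = just 0≡x
  ... | no  _   = nothing

-- The normalised fraction i / m represents the unnormalised fraction i/m;
-- this lets the fraction laws below be transported from ℚᵘ.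
/-unnormalised : ∀ i m .{{_ : NonZero m}} → toℚᵘ (i / m) ℚᵘ.≃ ℚᵘ.mkℚᵘ i (ℕ.pred m)
/-unnormalised i (suc m) = toℚᵘ-fromℚᵘ (ℚᵘ.mkℚᵘ i m)

/-cross : ∀ i j m n .{{_ : NonZero m}} .{{_ : NonZero n}} →
          i ℤ.* + n ≡ j ℤ.* + m → i / m ≡ j / n
/-cross i j (suc m) (suc n) eq = fromℚᵘ-cong {ℚᵘ.mkℚᵘ i m} {ℚᵘ.mkℚᵘ j n} (ℚᵘ.*≡* eq)

/-* : ∀ i j m n .{{_ : NonZero m}} .{{_ : NonZero n}} →
      (i / m) * (j / n) ≡ ((i ℤ.* j) / (m ℕ.* n)) {{m*n≢0 m n}}
/-* i j m@(suc _) n@(suc _) = toℚᵘ-injective (begin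
  toℚᵘ ((i / m) * (j / n))             ≈⟨ toℚᵘ-homo-* (i / m) (j / n) ⟩
  toℚᵘ (i / m) ℚᵘ.* toℚᵘ (j / n)       ≈⟨ ℚᵘ.*-cong (/-unnormalised i m) (/-unnormalised j n) ⟩
  ℚᵘ.mkℚᵘ (i ℤ.* j) (ℕ.pred (m ℕ.* n)) ≈⟨ /-unnormalised (i ℤ.* j) (m ℕ.* n) ⟨
  toℚᵘ ((i ℤ.* j) / (m ℕ.* n))         ∎)
  where open ℚᵘ.≃-Reasoning

/-+ : ∀ i j m n .{{_ : NonZero m}} .{{_ : NonZero n}} →
      (i / m) + (j / n) ≡ ((i ℤ.* + n ℤ.+ j ℤ.* + m) / (m ℕ.* n)) {{m*n≢0 m n}}
/-+ i j m@(suc _) n@(suc _) = toℚᵘ-injective (begin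
  toℚᵘ ((i / m) + (j / n))                               ≈⟨ toℚᵘ-homo-+ (i / m) (j / n) ⟩
  toℚᵘ (i / m) ℚᵘ.+ toℚᵘ (j / n)                         ≈⟨ ℚᵘ.+-cong (/-unnormalised i m) (/-unnormalised j n) ⟩
  ℚᵘ.mkℚᵘ (i ℤ.* + n ℤ.+ j ℤ.* + m) (ℕ.pred (m ℕ.* n)) ≈⟨ /-unnormalised (i ℤ.* + n ℤ.+ j ℤ.* + m) (m ℕ.* n) ⟨
  toℚᵘ ((i ℤ.* + n ℤ.+ j ℤ.* + m) / (m ℕ.* n))           ∎)
  where open ℚᵘ.≃-Reasoning

-/ : ∀ i m .{{_ : NonZero m}} → - (i / m) ≡ (ℤ.- i) / m
-/ i m@(suc _) = toℚᵘ-injective (begin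
  toℚᵘ (- (i / m))           ≈⟨ toℚᵘ-homo‿- (i / m) ⟩
  ℚᵘ.- toℚᵘ (i / m)          ≈⟨ ℚᵘ.-‿cong (/-unnormalised i m) ⟩
  ℚᵘ.mkℚᵘ (ℤ.- i) (ℕ.pred m) ≈⟨ /-unnormalised (ℤ.- i) m ⟨
  toℚᵘ ((ℤ.- i) / m)         ∎)
  where open ℚᵘ.≃-Reasoning

-- The embedding ℕ → ℚ in the form used by the statement, (+ n) / 1; it is a
-- semiring homomorphism.
ι : ℕ → ℚ
ι n = (+ n) / 1

ι-+ : ∀ m n → ι (m ℕ.+ n) ≡ ι m + ι n
ι-+ m n = sym (trans (/-+ (+ m) (+ n) 1 1)
  (/-cong (trans (cong₂ ℤ._+_ (ℤ.*-identityʳ (+ m)) (ℤ.*-identityʳ (+ n))) (sym (ℤ.pos-+ m n))) refl))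

ι-* : ∀ m n → ι (m ℕ.* n) ≡ ι m * ι n
ι-* m n = sym (trans (/-* (+ m) (+ n) 1 1) (/-cong (sym (ℤ.pos-* m n)) refl))

ι-suc : ∀ n → ι (suc n) ≡ 1ℚ + ι n
ι-suc = ι-+ 1

recip : (m : ℕ) → .{{NonZero m}} → ℚ
recip m = (+ 1) / m

ι*recip : ∀ m .{{_ : NonZero m}} → ι m * recip m ≡ 1ℚ
ι*recip m = trans (/-* (+ m) (+ 1) 1 m) (/-cross (+ m ℤ.* + 1) (+ 1) (1 ℕ.* m) 1 {{m*n≢0 1 m}} cross)
  where
  cross : + m ℤ.* + 1 ℤ.* + 1 ≡ + 1 ℤ.* + (1 ℕ.* m)
  cross = begin
    + m ℤ.* + 1 ℤ.* + 1 ≡⟨ ℤ.*-identityʳ (+ m ℤ.* + 1) ⟩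
    + m ℤ.* + 1         ≡⟨ ℤ.*-identityʳ (+ m) ⟩
    + m                 ≡⟨ cong +_ (ℕ.*-identityˡ m) ⟨
    + (1 ℕ.* m)         ≡⟨ ℤ.*-identityˡ (+ (1 ℕ.* m)) ⟨
    + 1 ℤ.* + (1 ℕ.* m) ∎
    where open ≡-Reasoning

recip-* : ∀ m n .{{_ : NonZero m}} .{{_ : NonZero n}} →
          (recip (m ℕ.* n)) {{m*n≢0 m n}} ≡ recip m * recip n
recip-* m n = sym (/-* (+ 1) (+ 1) m n)

/-split : ∀ i m .{{_ : NonZero m}} → i / m ≡ (i / 1) * recip m
/-split i m = sym (trans (/-* i (+ 1) 1 m) (/-cong {{m*n≢0 1 m}} (ℤ.*-identityʳ i) (ℕ.*-identityˡ m)))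

solve-for : ∀ q N d .{{_ : NonZero d}} → q * ι d ≡ - ι N → q ≡ - ((+ N) / d)
solve-for q N d eq = begin
  q                       ≡⟨ *-identityʳ q ⟨
  q * 1ℚ                  ≡⟨ cong (q *_) (ι*recip d) ⟨
  q * (ι d * recip d)     ≡⟨ *-assoc q (ι d) (recip d) ⟨
  q * ι d * recip d       ≡⟨ cong (_* recip d) eq ⟩
  - ι N * recip d         ≡⟨ neg-distribˡ-* (ι N) (recip d) ⟨
  - (ι N * recip d)       ≡⟨ cong -_ (/-split (+ N) d) ⟨
  - ((+ N) / d)           ∎
  where open ≡-Reasoning

sgn : ℕ → ℚ
sgn j = (-1ℤ ^ j) / 1

sgn-suc : ∀ j → sgn (suc j) ≡ - sgn j
sgn-suc j = trans (/-cong (ℤ.-1*i≡-i (-1ℤ ^ j)) refl) (sym (-/ (-1ℤ ^ j) 1))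

Δ : ℕ → (ℕ → ℚ) → ℚ
Δ zero    x = x 0
Δ (suc n) x = Δ n x - Δ n (x ∘ suc)

Δ-cong : ∀ n {x y : ℕ → ℚ} → (∀ j → x j ≡ y j) → Δ n x ≡ Δ n y
Δ-cong zero    x≡y = x≡y 0
Δ-cong (suc n) x≡y = cong₂ _-_ (Δ-cong n x≡y) (Δ-cong n (x≡y ∘ suc))

Δ-+ : ∀ n x y → Δ n (λ j → x j + y j) ≡ Δ n x + Δ n y
Δ-+ zero    x y = refl
Δ-+ (suc n) x y = begin
  Δ n (λ j → x j + y j) - Δ n (λ j → x (suc j) + y (suc j))
    ≡⟨ cong₂ _-_ (Δ-+ n x y) (Δ-+ n (x ∘ suc) (y ∘ suc)) ⟩
  (Δ n x + Δ n y) - (Δ n (x ∘ suc) + Δ n (y ∘ suc))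
    ≡⟨ interchange (Δ n x) (Δ n y) (Δ n (x ∘ suc)) (Δ n (y ∘ suc)) ⟩
  (Δ n x - Δ n (x ∘ suc)) + (Δ n y - Δ n (y ∘ suc)) ∎
  where
  open ≡-Reasoning
  interchange : ∀ a b c d → (a + b) - (c + d) ≡ (a - c) + (b - d)
  interchange = solve-∀ ℚ-ring

Δ-* : ∀ n c x → Δ n (λ j → c * x j) ≡ c * Δ n x
Δ-* zero    c x = refl
Δ-* (suc n) c x = trans (cong₂ _-_ (Δ-* n c x) (Δ-* n c (x ∘ suc)))
                        (sym (*-distribˡ-- c (Δ n x) (Δ n (x ∘ suc))))
  where
  *-distribˡ-- : ∀ c a b → c * (a - b) ≡ c * a - c * b
  *-distribˡ-- = solve-∀ ℚ-ring

Δ-const : ∀ n c → Δ (suc n) (λ _ → c) ≡ 0ℚ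
Δ-const n c = +-inverseʳ (Δ n (λ _ → c))

Δ-index : ∀ n x → Δ (suc n) (λ j → ι j * x j) ≡ - (ι (suc n) * Δ n (x ∘ suc))
Δ-index zero    x = base (x 0) (x 1)
  where
  base : ∀ p q → 0ℚ * p - 1ℚ * q ≡ - (1ℚ * q)
  base = solve-∀ ℚ-ring
Δ-index (suc n) x = begin
  Δ (suc n) (λ j → ι j * x j) - Δ (suc n) (λ j → ι (suc j) * x (suc j))
    ≡⟨ cong (λ t → Δ (suc n) (λ j → ι j * x j) - t) (trans (Δ-cong (suc n) split) (Δ-+ (suc n) _ _)) ⟩
  Δ (suc n) (λ j → ι j * x j) - (Δ (suc n) (λ j → ι j * x (suc j)) + Δ (suc n) (x ∘ suc))
    ≡⟨ cong₂ (λ p q → p - (q + Δ (suc n) (x ∘ suc))) (Δ-index n x) (Δ-index n (x ∘ suc)) ⟩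
  - (A * a) - (- (A * b) + (a - b))
    ≡⟨ collect A a b ⟩
  - ((1ℚ + A) * (a - b))
    ≡⟨ cong (λ t → - (t * (a - b))) (ι-suc (suc n)) ⟨
  - (ι (suc (suc n)) * Δ (suc n) (x ∘ suc)) ∎
  where
  open ≡-Reasoning
  A = ι (suc n)
  a = Δ n (x ∘ suc)
  b = Δ n (x ∘ suc ∘ suc)
  distrib : ∀ i t → (1ℚ + i) * t ≡ i * t + t
  distrib = solve-∀ ℚ-ring
  split : ∀ j → ι (suc j) * x (suc j) ≡ ι j * x (suc j) + x (suc j)
  split j = trans (cong (_* x (suc j)) (ι-suc j)) (distrib (ι j) (x (suc j)))
  collect : ∀ A a b → - (A * a) - (- (A * b) + (a - b)) ≡ - ((1ℚ + A) * (a - b))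
  collect = solve-∀ ℚ-ring

-- The key recurrence: for sequences related by (αj + 1)·x_j = z_j, applying
-- Δⁿ⁺¹ and using Δ-index turns the factor (αj + 1) into (1 + α(n+1)).
Δ-recurrence : ∀ α (x z : ℕ → ℚ) → (∀ j → (α * ι j + 1ℚ) * x j ≡ z j) → ∀ n →
               Δ (suc n) x * (1ℚ + α * ι (suc n)) ≡ α * ι (suc n) * Δ n x + Δ (suc n) z
Δ-recurrence α x z hyp n = begin
  (b - c) * (1ℚ + α * A)                  ≡⟨ expand α A b c ⟩
  α * A * b + (α * (- (A * c)) + (b - c)) ≡⟨ cong (_+_ (α * A * b)) Δz ⟨
  α * A * b + Δ (suc n) z                 ∎
  where
  open ≡-Reasoning
  A = ι (suc n)
  b = Δ n x
  c = Δ n (x ∘ suc)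
  expand : ∀ α A b c → (b - c) * (1ℚ + α * A) ≡ α * A * b + (α * (- (A * c)) + (b - c))
  expand = solve-∀ ℚ-ring
  distrib : ∀ α i t → (α * i + 1ℚ) * t ≡ α * (i * t) + t
  distrib = solve-∀ ℚ-ring
  Δz : Δ (suc n) z ≡ α * (- (A * c)) + (b - c)
  Δz = begin
    Δ (suc n) z                                     ≡⟨ Δ-cong (suc n) (λ j → trans (sym (hyp j)) (distrib α (ι j) (x j))) ⟩
    Δ (suc n) (λ j → α * (ι j * x j) + x j)         ≡⟨ Δ-+ (suc n) _ x ⟩
    Δ (suc n) (λ j → α * (ι j * x j)) + Δ (suc n) x ≡⟨ cong (_+ Δ (suc n) x) (Δ-* (suc n) α _) ⟩
    α * Δ (suc n) (λ j → ι j * x j) + Δ (suc n) x   ≡⟨ cong (λ t → α * t + Δ (suc n) x) (Δ-index n x) ⟩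
    α * (- (A * c)) + (b - c)                       ∎

Δ-reciprocal : ∀ α (x : ℕ → ℚ) → (∀ j → (α * ι j + 1ℚ) * x j ≡ 1ℚ) → ∀ n →
               Δ (suc n) x * (1ℚ + α * ι (suc n)) ≡ α * ι (suc n) * Δ n x
Δ-reciprocal α x hyp n = begin
  Δ (suc n) x * (1ℚ + α * ι (suc n))           ≡⟨ Δ-recurrence α x (λ _ → 1ℚ) hyp n ⟩
  α * ι (suc n) * Δ n x + Δ (suc n) (λ _ → 1ℚ) ≡⟨ cong (_+_ (α * ι (suc n) * Δ n x)) (Δ-const n 1ℚ) ⟩
  α * ι (suc n) * Δ n x + 0ℚ                   ≡⟨ +-identityʳ (α * ι (suc n) * Δ n x) ⟩
  α * ι (suc n) * Δ n x                        ∎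
  where open ≡-Reasoning

sumTo-cong : ∀ m {f g : ℕ → ℚ} → (∀ j → f j ≡ g j) → sumTo m f ≡ sumTo m g
sumTo-cong zero    f≡g = refl
sumTo-cong (suc m) f≡g = cong₂ _+_ (sumTo-cong m f≡g) (f≡g m)

sumTo-- : ∀ m f g → sumTo m (λ j → f j - g j) ≡ sumTo m f - sumTo m g
sumTo-- zero    f g = refl
sumTo-- (suc m) f g = trans (cong (_+ (f m - g m)) (sumTo-- m f g))
                            (interchange (sumTo m f) (sumTo m g) (f m) (g m))
  where
  interchange : ∀ a b c d → (a - b) + (c - d) ≡ (a + c) - (b + d)
  interchange = solve-∀ ℚ-ring

sumTo-peel : ∀ m f → sumTo (suc m) f ≡ f 0 + sumTo m (f ∘ suc)
sumTo-peel zero    f = trans (+-identityˡ (f 0)) (sym (+-identityʳ (f 0)))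
sumTo-peel (suc m) f = trans (cong (_+ f (suc m)) (sumTo-peel m f))
                             (+-assoc (f 0) (sumTo m (f ∘ suc)) (f (suc m)))

binomialTerm : ℕ → (ℕ → ℚ) → ℕ → ℚ
binomialTerm n x j = ι (n C j) * sgn j * x j

binomialTerm-pascal : ∀ n x j →
  binomialTerm (suc n) x (suc j) ≡ binomialTerm n x (suc j) - binomialTerm n (x ∘ suc) j
binomialTerm-pascal n x j = begin
  ι (suc n C suc j) * sgn (suc j) * x (suc j)
    ≡⟨ cong (λ k → ι k * sgn (suc j) * x (suc j)) (nCk+nC[k+1]≡[n+1]C[k+1] n j) ⟨
  ι (n C j ℕ.+ n C suc j) * sgn (suc j) * x (suc j)
    ≡⟨ cong₂ (λ c s → c * s * x (suc j)) (ι-+ (n C j) (n C suc j)) (sgn-suc j) ⟩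
  (ι (n C j) + ι (n C suc j)) * - sgn j * x (suc j)
    ≡⟨ rearrange (ι (n C j)) (ι (n C suc j)) (sgn j) (x (suc j)) ⟩
  ι (n C suc j) * - sgn j * x (suc j) - ι (n C j) * sgn j * x (suc j)
    ≡⟨ cong (λ s → ι (n C suc j) * s * x (suc j) - binomialTerm n (x ∘ suc) j) (sgn-suc j) ⟨
  binomialTerm n x (suc j) - binomialTerm n (x ∘ suc) j ∎
  where
  open ≡-Reasoning
  rearrange : ∀ c d s t → (c + d) * - s * t ≡ d * - s * t - c * s * t
  rearrange = solve-∀ ℚ-ring

binomialTerm-top : ∀ n x → binomialTerm n x (suc n) ≡ 0ℚ
binomialTerm-top n x = begin
  ι (n C suc n) * sgn (suc n) * x (suc n) ≡⟨ cong (λ k → ι k * sgn (suc n) * x (suc n)) (k>n⇒nCk≡0 (ℕ.n<1+n n)) ⟩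
  0ℚ * sgn (suc n) * x (suc n)           ≡⟨ cong (_* x (suc n)) (*-zeroˡ (sgn (suc n))) ⟩
  0ℚ * x (suc n)                          ≡⟨ *-zeroˡ (x (suc n)) ⟩
  0ℚ                                      ∎
  where open ≡-Reasoning

Δ-binomial : ∀ n x → sumTo (suc n) (binomialTerm n x) ≡ Δ n x
Δ-binomial zero    x = trans (+-identityˡ _) (*-identityˡ (x 0))
Δ-binomial (suc n) x = begin
  sumTo (suc (suc n)) (binomialTerm (suc n) x)
    ≡⟨ sumTo-peel (suc n) (binomialTerm (suc n) x) ⟩
  T₀ + sumTo (suc n) (λ j → binomialTerm (suc n) x (suc j))
    ≡⟨ cong (_+_ T₀) (trans (sumTo-cong (suc n) (binomialTerm-pascal n x)) (sumTo-- (suc n) _ _)) ⟩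
  T₀ + (sumTo (suc n) (binomialTerm n x ∘ suc) - S′)
    ≡⟨ +-assoc T₀ (sumTo (suc n) (binomialTerm n x ∘ suc)) (- S′) ⟨
  (T₀ + sumTo (suc n) (binomialTerm n x ∘ suc)) - S′
    ≡⟨ cong (_- S′) (sumTo-peel (suc n) (binomialTerm n x)) ⟨
  (sumTo (suc n) (binomialTerm n x) + binomialTerm n x (suc n)) - S′
    ≡⟨ cong₂ _-_ (trans (cong (_+_ (sumTo (suc n) (binomialTerm n x))) (binomialTerm-top n x))
                        (+-identityʳ (sumTo (suc n) (binomialTerm n x))))
                 (Δ-binomial n (x ∘ suc)) ⟩
  sumTo (suc n) (binomialTerm n x) - Δ n (x ∘ suc)
    ≡⟨ cong (_- Δ n (x ∘ suc)) (Δ-binomial n x) ⟩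
  Δ (suc n) x ∎
  where
  open ≡-Reasoning
  T₀ = binomialTerm n x 0
  S′ = sumTo (suc n) (binomialTerm n (x ∘ suc))

2[1+n]≡2+2n : ∀ n → 2 ℕ.* suc n ≡ suc (suc (2 ℕ.* n))
2[1+n]≡2+2n = ℕ-Solver.solve-∀

2[1+n]≡1+[2n+1] : ∀ n → 2 ℕ.* suc n ≡ suc (2 ℕ.* n ℕ.+ 1)
2[1+n]≡1+[2n+1] = ℕ-Solver.solve-∀

2[1+n]+1≡3+2n : ∀ n → 2 ℕ.* suc n ℕ.+ 1 ≡ suc (suc (2 ℕ.* n ℕ.+ 1))
2[1+n]+1≡3+2n = ℕ-Solver.solve-∀

even!!-suc : ∀ n → ι ((2 ℕ.* suc n) !!) ≡ ι 2 * ι (suc n) * ι ((2 ℕ.* n) !!)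
even!!-suc n = begin
  ι ((2 ℕ.* suc n) !!)                       ≡⟨ cong (λ k → ι (k !!)) (2[1+n]≡2+2n n) ⟩
  ι (suc (suc (2 ℕ.* n)) ℕ.* (2 ℕ.* n) !!)   ≡⟨ ι-* (suc (suc (2 ℕ.* n))) ((2 ℕ.* n) !!) ⟩
  ι (suc (suc (2 ℕ.* n))) * ι ((2 ℕ.* n) !!) ≡⟨ cong (λ k → ι k * ι ((2 ℕ.* n) !!)) (2[1+n]≡2+2n n) ⟨
  ι (2 ℕ.* suc n) * ι ((2 ℕ.* n) !!)         ≡⟨ cong (_* ι ((2 ℕ.* n) !!)) (ι-* 2 (suc n)) ⟩
  ι 2 * ι (suc n) * ι ((2 ℕ.* n) !!)         ∎
  where open ≡-Reasoning

odd!!-suc : ∀ n → ι ((2 ℕ.* suc n ℕ.+ 1) !!) ≡ (1ℚ + ι 2 * ι (suc n)) * ι ((2 ℕ.* n ℕ.+ 1) !!)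
odd!!-suc n = begin
  ι ((2 ℕ.* suc n ℕ.+ 1) !!)                               ≡⟨ cong (λ k → ι (k !!)) (2[1+n]+1≡3+2n n) ⟩
  ι (suc (suc (2 ℕ.* n ℕ.+ 1)) ℕ.* (2 ℕ.* n ℕ.+ 1) !!)     ≡⟨ ι-* (suc (suc (2 ℕ.* n ℕ.+ 1))) ((2 ℕ.* n ℕ.+ 1) !!) ⟩
  ι (suc (suc (2 ℕ.* n ℕ.+ 1))) * ι ((2 ℕ.* n ℕ.+ 1) !!)   ≡⟨ cong (λ k → ι (suc k) * ι ((2 ℕ.* n ℕ.+ 1) !!)) (2[1+n]≡1+[2n+1] n) ⟨
  ι (suc (2 ℕ.* suc n)) * ι ((2 ℕ.* n ℕ.+ 1) !!)           ≡⟨ cong (_* ι ((2 ℕ.* n ℕ.+ 1) !!)) (trans (ι-suc (2 ℕ.* suc n)) (cong (_+_ 1ℚ) (ι-* 2 (suc n)))) ⟩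
  (1ℚ + ι 2 * ι (suc n)) * ι ((2 ℕ.* n ℕ.+ 1) !!)          ∎
  where open ≡-Reasoning

w : ℕ → ℚ
w j = recip (suc j)

w-hyp : ∀ j → (1ℚ * ι j + 1ℚ) * w j ≡ 1ℚ
w-hyp j = trans (cong (_* w j) denominator) (ι*recip (suc j))
  where
  denominator : 1ℚ * ι j + 1ℚ ≡ ι (suc j)
  denominator = trans (cong (_+ 1ℚ) (*-identityˡ (ι j))) (trans (+-comm (ι j) 1ℚ) (sym (ι-suc j)))

Δ-w : ∀ n → Δ n w * ι (suc n) ≡ 1ℚ
Δ-w zero    = refl
Δ-w (suc n) = begin
  Δ (suc n) w * ι (suc (suc n))       ≡⟨ cong (Δ (suc n) w *_) (trans (ι-suc (suc n)) (cong (_+_ 1ℚ) (sym (*-identityˡ (ι (suc n)))))) ⟩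
  Δ (suc n) w * (1ℚ + 1ℚ * ι (suc n)) ≡⟨ Δ-reciprocal 1ℚ w w-hyp n ⟩
  1ℚ * ι (suc n) * Δ n w              ≡⟨ trans (cong (_* Δ n w) (*-identityˡ (ι (suc n)))) (*-comm (ι (suc n)) (Δ n w)) ⟩
  Δ n w * ι (suc n)                   ≡⟨ Δ-w n ⟩
  1ℚ                                  ∎
  where open ≡-Reasoning

u : ℕ → ℚ
u j = recip (suc (2 ℕ.* j))

u-hyp : ∀ j → (ι 2 * ι j + 1ℚ) * u j ≡ 1ℚ
u-hyp j = trans (cong (_* u j) denominator) (ι*recip (suc (2 ℕ.* j)))
  where
  denominator : ι 2 * ι j + 1ℚ ≡ ι (suc (2 ℕ.* j))
  denominator = sym (trans (ι-suc (2 ℕ.* j)) (trans (cong (_+_ 1ℚ) (ι-* 2 j)) (+-comm 1ℚ (ι 2 * ι j))))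

Δ-u : ∀ n → Δ n u * ι ((2 ℕ.* n ℕ.+ 1) !!) ≡ ι ((2 ℕ.* n) !!)
Δ-u zero    = refl
Δ-u (suc n) = begin
  Δ (suc n) u * ι ((2 ℕ.* suc n ℕ.+ 1) !!)   ≡⟨ cong (Δ (suc n) u *_) (odd!!-suc n) ⟩
  Δ (suc n) u * ((1ℚ + ι 2 * ι (suc n)) * B) ≡⟨ *-assoc (Δ (suc n) u) (1ℚ + ι 2 * ι (suc n)) B ⟨
  Δ (suc n) u * (1ℚ + ι 2 * ι (suc n)) * B   ≡⟨ cong (_* B) (Δ-reciprocal (ι 2) u u-hyp n) ⟩
  ι 2 * ι (suc n) * Δ n u * B                ≡⟨ *-assoc (ι 2 * ι (suc n)) (Δ n u) B ⟩
  ι 2 * ι (suc n) * (Δ n u * B)              ≡⟨ cong (ι 2 * ι (suc n) *_) (Δ-u n) ⟩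
  ι 2 * ι (suc n) * ι ((2 ℕ.* n) !!)         ≡⟨ even!!-suc n ⟨
  ι ((2 ℕ.* suc n) !!)                       ∎
  where
  open ≡-Reasoning
  B = ι ((2 ℕ.* n ℕ.+ 1) !!)

-- a_j = H(j) − 2H(2j+1) satisfies a_{j+1} = a_j − 2u_{j+1}, since
-- H(j+1) − H(j) = 1/(j+1) = 2·1/(2j+2) and H(2j+3) − H(2j+1) = 1/(2j+2) + 1/(2j+3).
a : ℕ → ℚ
a j = H j - ι 2 * H (2 ℕ.* j ℕ.+ 1)

a-suc : ∀ j → a (suc j) ≡ a j + - ι 2 * u (suc j)
a-suc j = begin
  (H j + w j) - ι 2 * H (2 ℕ.* suc j ℕ.+ 1)
    ≡⟨ cong (λ k → (H j + w j) - ι 2 * H k) (2[1+n]+1≡3+2n j) ⟩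
  (H j + w j) - ι 2 * (H (2 ℕ.* j ℕ.+ 1) + recip (suc (2 ℕ.* j ℕ.+ 1)) + recip (suc (suc (2 ℕ.* j ℕ.+ 1))))
    ≡⟨ cong₂ (λ p q → (H j + w j) - ι 2 * (H (2 ℕ.* j ℕ.+ 1) + p + q)) even-term odd-term ⟩
  (H j + w j) - ι 2 * (H (2 ℕ.* j ℕ.+ 1) + recip 2 * w j + u (suc j))
    ≡⟨ cancel (H j) (H (2 ℕ.* j ℕ.+ 1)) (w j) (u (suc j)) ⟩
  a j + - ι 2 * u (suc j) ∎
  where
  open ≡-Reasoning
  even-term : recip (suc (2 ℕ.* j ℕ.+ 1)) ≡ recip 2 * w j
  even-term = trans (/-cong {+ 1} refl (sym (2[1+n]≡1+[2n+1] j))) (recip-* 2 (suc j))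
  odd-term : recip (suc (suc (2 ℕ.* j ℕ.+ 1))) ≡ u (suc j)
  odd-term = cong (λ k → recip (suc k)) (sym (2[1+n]≡1+[2n+1] j))
  cancel : ∀ h v p q → (h + p) - ι 2 * (v + recip 2 * p + q) ≡ (h - ι 2 * v) + - ι 2 * q
  cancel = solve-∀ ℚ-ring

Δ-a : ∀ n → Δ (suc n) a ≡ ι 2 * Δ n (u ∘ suc)
Δ-a n = begin
  Δ n a - Δ n (a ∘ suc)                           ≡⟨ cong (_-_ (Δ n a)) (trans (Δ-cong n a-suc) (Δ-+ n a _)) ⟩
  Δ n a - (Δ n a + Δ n (λ j → - ι 2 * u (suc j))) ≡⟨ cong (λ t → Δ n a - (Δ n a + t)) (Δ-* n (- ι 2) (u ∘ suc)) ⟩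
  Δ n a - (Δ n a + - ι 2 * Δ n (u ∘ suc))         ≡⟨ cancel (Δ n a) (Δ n (u ∘ suc)) ⟩
  ι 2 * Δ n (u ∘ suc)                             ∎
  where
  open ≡-Reasoning
  cancel : ∀ p q → p - (p + - ι 2 * q) ≡ ι 2 * q
  cancel = solve-∀ ℚ-ring

y : ℕ → ℚ
y j = w j * a j

y-hyp : ∀ j → (1ℚ * ι j + 1ℚ) * y j ≡ a j
y-hyp j = begin
  (1ℚ * ι j + 1ℚ) * (w j * a j) ≡⟨ *-assoc (1ℚ * ι j + 1ℚ) (w j) (a j) ⟨
  (1ℚ * ι j + 1ℚ) * w j * a j   ≡⟨ cong (_* a j) (w-hyp j) ⟩
  1ℚ * a j                      ≡⟨ *-identityˡ (a j) ⟩
  a j                           ∎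
  where open ≡-Reasoning

Δ-y-step : ∀ n → ι (suc (suc n)) * Δ (suc n) y ≡ ι (suc n) * Δ n y + ι 2 * Δ n (u ∘ suc)
Δ-y-step n = begin
  ι (suc (suc n)) * Δ (suc n) y   ≡⟨ cong (_* Δ (suc n) y) (ι-suc (suc n)) ⟩
  (1ℚ + A) * Δ (suc n) y          ≡⟨ unit-coefficients A (Δ (suc n) y) ⟩
  Δ (suc n) y * (1ℚ + 1ℚ * A)     ≡⟨ Δ-recurrence 1ℚ y a y-hyp n ⟩
  1ℚ * A * Δ n y + Δ (suc n) a    ≡⟨ cong₂ _+_ (cong (_* Δ n y) (*-identityˡ A)) (Δ-a n) ⟩
  A * Δ n y + ι 2 * Δ n (u ∘ suc) ∎
  where
  open ≡-Reasoning
  A = ι (suc n)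
  unit-coefficients : ∀ A Y → (1ℚ + A) * Y ≡ Y * (1ℚ + 1ℚ * A)
  unit-coefficients = solve-∀ ℚ-ring

-- The invariant (n+1)·Δⁿy + 2·Δⁿu, which vanishes at n = 0, hence everywhere.
Δ-y-invariant : ∀ n → ι (suc n) * Δ n y + ι 2 * Δ n u ≡ 0ℚ
Δ-y-invariant zero    = refl
Δ-y-invariant (suc n) = begin
  ι (suc (suc n)) * Δ (suc n) y + ι 2 * (Δ n u - Δ n (u ∘ suc))
    ≡⟨ cong (_+ ι 2 * (Δ n u - Δ n (u ∘ suc))) (Δ-y-step n) ⟩
  (ι (suc n) * Δ n y + ι 2 * Δ n (u ∘ suc)) + ι 2 * (Δ n u - Δ n (u ∘ suc))
    ≡⟨ telescope (ι (suc n) * Δ n y) (ι 2) (Δ n u) (Δ n (u ∘ suc)) ⟩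
  ι (suc n) * Δ n y + ι 2 * Δ n u
    ≡⟨ Δ-y-invariant n ⟩
  0ℚ ∎
  where
  open ≡-Reasoning
  telescope : ∀ p t q r → (p + t * r) + t * (q - r) ≡ p + t * q
  telescope = solve-∀ ℚ-ring

Δ-y : ∀ n → Δ n y * ι (suc n ℕ.* suc n ℕ.* (2 ℕ.* n ℕ.+ 1) !!) ≡ - ι ((2 ℕ.* suc n) !!)
Δ-y n = begin
  Y * ι (suc n ℕ.* suc n ℕ.* (2 ℕ.* n ℕ.+ 1) !!)
    ≡⟨ cong (Y *_) (trans (ι-* (suc n ℕ.* suc n) ((2 ℕ.* n ℕ.+ 1) !!)) (cong (_* B) (ι-* (suc n) (suc n)))) ⟩
  Y * (A * A * B)
    ≡⟨ regroup Y A B (ι 2) U ⟩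
  A * B * (A * Y + ι 2 * U) - ι 2 * A * (U * B)
    ≡⟨ cong₂ (λ p q → A * B * p - ι 2 * A * q) (Δ-y-invariant n) (Δ-u n) ⟩
  A * B * 0ℚ - ι 2 * A * ι ((2 ℕ.* n) !!)
    ≡⟨ annihilate (A * B) (ι 2 * A * ι ((2 ℕ.* n) !!)) ⟩
  - (ι 2 * A * ι ((2 ℕ.* n) !!))
    ≡⟨ cong -_ (even!!-suc n) ⟨
  - ι ((2 ℕ.* suc n) !!) ∎
  where
  open ≡-Reasoning
  Y = Δ n y
  A = ι (suc n)
  B = ι ((2 ℕ.* n ℕ.+ 1) !!)
  U = Δ n u
  regroup : ∀ Y A B t U → Y * (A * A * B) ≡ A * B * (A * Y + t * U) - t * A * (U * B)
  regroup = solve-∀ ℚ-ring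
  annihilate : ∀ p q → p * 0ℚ - q ≡ - q
  annihilate = solve-∀ ℚ-ring

summand≡binomialTerm : ∀ n ℓ →
  ι (n C ℓ) * ((-1ℤ ^ ℓ) / suc ℓ) * (H ℓ - (+ 2) / 1 * H (2 ℕ.* ℓ ℕ.+ 1)) ≡ binomialTerm n y ℓ
summand≡binomialTerm n ℓ = begin
  ι (n C ℓ) * ((-1ℤ ^ ℓ) / suc ℓ) * a ℓ ≡⟨ cong (λ t → ι (n C ℓ) * t * a ℓ) (/-split (-1ℤ ^ ℓ) (suc ℓ)) ⟩
  ι (n C ℓ) * (sgn ℓ * w ℓ) * a ℓ       ≡⟨ reassociate (ι (n C ℓ)) (sgn ℓ) (w ℓ) (a ℓ) ⟩
  ι (n C ℓ) * sgn ℓ * (w ℓ * a ℓ)       ∎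
  where
  open ≡-Reasoning
  reassociate : ∀ c s p q → c * (s * p) * q ≡ c * s * (p * q)
  reassociate = solve-∀ ℚ-ring

lemma3p7 : (r : ℕ) → .{{_ : NonZero r}} →
    sumTo r (λ ℓ → ((+ ((r ∸ 1) C ℓ)) / 1) * ((-1ℤ ^ ℓ) / (Data.Nat.suc ℓ))
                    * (H ℓ - (+ 2) / 1 * H (2 Data.Nat.* ℓ Data.Nat.+ 1)))
      ≡ - (_/_ (+ ((2 Data.Nat.* r) !!)) (r Data.Nat.* r Data.Nat.* ((2 Data.Nat.* r ∸ 1) !!))
             {{ m*n≢0 (r Data.Nat.* r) ((2 Data.Nat.* r ∸ 1) !!) {{ m*n≢0 r r }} {{ !!≢0 (2 Data.Nat.* r ∸ 1) }} }})
lemma3p7 (suc n) = begin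
  sumTo (suc n) _                  ≡⟨ sumTo-cong (suc n) (summand≡binomialTerm n) ⟩
  sumTo (suc n) (binomialTerm n y) ≡⟨ Δ-binomial n y ⟩
  Δ n y                            ≡⟨ solve-for (Δ n y) ((2 ℕ.* suc n) !!) d {{d≢0}} Δ-y′ ⟩
  - ((+ ((2 ℕ.* suc n) !!)) / d) {{d≢0}} ∎
  where
  open ≡-Reasoning
  d : ℕ
  d = suc n ℕ.* suc n ℕ.* (2 ℕ.* suc n ∸ 1) !!
  d≢0 : NonZero d
  d≢0 = m*n≢0 (suc n ℕ.* suc n) ((2 ℕ.* suc n ∸ 1) !!) {{m*n≢0 (suc n) (suc n)}} {{ !!≢0 (2 ℕ.* suc n ∸ 1) }}
  -- Δ-y with 2(n+1) − 1 written as 2n + 1.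
  Δ-y′ : Δ n y * ι d ≡ - ι ((2 ℕ.* suc n) !!)
  Δ-y′ = subst (λ k → Δ n y * ι (suc n ℕ.* suc n ℕ.* k !!) ≡ - ι ((2 ℕ.* suc n) !!))
               (cong (ℕ._∸ 1) (sym (2[1+n]≡1+[2n+1] n))) (Δ-y n)
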